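{- Every digraph that has a normal spanning arborescence has countable dichromatic number.
   Context: The dichromatic number of a digraph $D$ is the smallest cardinal $\kappa$ such that $V(D)$ can be partitioned into $\kappa$ classes each inducing an acyclic subdigraph of $D$. An arborescence is a rooted oriented tree $T$ containing a directed path from the root to every vertex. We write $v\le_T w$ if $T$ has a directed path from $v$ to $w$, and $\lfloor v\rfloor_T=\{w: v\le_T w\}$. A $T$-path is a non-trivial directed path in $D$ meeting $T$ exactly in its endvertices. The normal assistant of $T$ in $D$ is obtained from $T$ by adding an edge $vw$ for every two $\le_T$-incomparable $v,w\in V(T)$ for which $D$ has a $T$-path from $\lfloor v\rfloor_T$ to $\lfloor w\rfloor_T$. $T$ is normal in $D$ if its normal assistant is acyclic. A normal spanning arborescence is a normal arborescence $T$ with $V(T)=V(D)$. -}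

module Defs where

open import Data.Nat using (ℕ; zero; suc; _≤_)
open import Data.List using (List; []; _∷_)
open import Data.List.Relation.Unary.Unique.Propositional using (Unique)
open import Data.Product using (Σ; _×_; _,_; ∃; ∃-syntax)
open import Data.Sum using (_⊎_)
open import Data.Unit using (⊤)
open import Relation.Nullary using (¬_)
open import Relation.Binary.PropositionalEquality using (_≡_)

record Digraph : Set₁ where
  field
    V        : Set
    E        : V → V → Set
    loopless : ∀ {v} → ¬ E v v

module _ {V : Set} where

  data Walk (R : V → V → Set) : V → V → Set where
    []  : ∀ {x} → Walk R x x
    _∷_ : ∀ {x y z} → R x y → Walk R y z → Walk R x z

  verts : ∀ {R x y} → Walk R x y → List V
  verts {x = x} []      = x ∷ []
  verts {x = x} (e ∷ w) = x ∷ verts w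

  len : ∀ {R x y} → Walk R x y → ℕ
  len []      = 0
  len (e ∷ w) = suc (len w)

  Path : (R : V → V → Set) → V → V → Set
  Path R x y = Σ (Walk R x y) λ w → Unique (verts w)

  AllMid : (P : V → Set) → ∀ {R x y} → Walk R x y → Set
  AllMid P []                  = ⊤
  AllMid P (_∷_ {x = y} e w)   = P y × AllMid P w

  AllInner : (P : V → Set) → ∀ {R x y} → Walk R x y → Set
  AllInner P []      = ⊤
  AllInner P (e ∷ w) = AllMid P w

  Cycle : (V → V → Set) → Set
  Cycle R = Σ V λ x → Σ V λ y → Path R x y × R y x

  Acyclic : (V → V → Set) → Set
  Acyclic R = ¬ Cycle R

  -- An undirected cycle of length ≥ 3 in the underlying graph of R.
  UAdj : (V → V → Set) → V → V → Set
  UAdj R u v = R u v ⊎ R v u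

  UCycle : (V → V → Set) → Set
  UCycle R = Σ V λ x → Σ V λ y →
    Σ (Path (UAdj R) x y) λ p → (2 ≤ len (Data.Product.proj₁ p)) × UAdj R y x

record Arborescence (D : Digraph) : Set₁ where
  open Digraph D
  field
    inT      : V → Set
    Tₑ       : V → V → Set
    Tₑ⊆E     : ∀ {u v} → Tₑ u v → E u v
    Tₑ-ends  : ∀ {u v} → Tₑ u v → inT u × inT v
    root     : V
    root∈T   : inT root
    oriented : ∀ {u v} → ¬ (Tₑ u v × Tₑ v u)
    -- tree: the underlying graph has no cycle (connectivity follows from reach)
    noCycle  : ¬ UCycle Tₑ
    reach    : ∀ v → inT v → Path Tₑ root v

module _ {D : Digraph} (T : Arborescence D) where
  open Digraph D
  open Arborescence T

  _≤T_ : V → V → Set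
  v ≤T w = Path Tₑ v w

  TPath : V → V → Set
  TPath a b = inT a × inT b ×
    Σ (Path E a b) λ p → (1 ≤ len (Data.Product.proj₁ p)) ×
      AllInner (λ z → ¬ inT z) (Data.Product.proj₁ p)

  Incomparable : V → V → Set
  Incomparable v w = inT v × inT w × ¬ (v ≤T w) × ¬ (w ≤T v)

  NormalAssistant : V → V → Set
  NormalAssistant v w = Tₑ v w ⊎
    (Incomparable v w × Σ V λ a → Σ V λ b → (v ≤T a) × (w ≤T b) × TPath a b)

  IsNormal : Set
  IsNormal = Acyclic NormalAssistant

  IsSpanning : Set
  IsSpanning = ∀ v → inT v

Induced : (D : Digraph) → (Digraph.V D → Set) → Digraph.V D → Digraph.V D → Set
Induced D S u v = S u × S v × Digraph.E D u v

-- D has dichromatic number at most ℵ₀: V(D) can be partitioned into countably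
-- many classes (indexed by ℕ) each inducing an acyclic subdigraph.
CountableDichromatic : Digraph → Set
CountableDichromatic D =
  Σ (Digraph.V D → ℕ) λ c → ∀ (k : ℕ) → Acyclic (Induced D (λ v → c v ≡ k))

{-# OPTIONS --safe #-}
module Submission where

-- Colour each vertex by its depth in T. In a tree all root walks to a vertex have
-- the same length, so T-walks strictly increase depth; hence two vertices
-- of equal depth are ≤T-incomparable, and a D-edge between them is a one-edge
-- T-path, i.e. an edge of the normal assistant. A monochromatic cycle is thus a
-- cycle of the normal assistant, which normality forbids.

open import Defs
open import Relation.Binary.Core using (_⇒_)
open import Function using (flip; _∘_)
open import Data.Product using (Σ; _,_; proj₁)
open import Data.Nat using (ℕ; suc; _+_; z≤n; s≤s)
open import Data.Nat.Properties using (_≟_; +-comm; m+1+n≢m)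
open import Data.List using (_∷_; drop)
open import Data.List.Relation.Unary.All using (All; []; _∷_)
open import Data.List.Relation.Unary.All.Properties using (¬Any⇒All¬) renaming (drop⁺ to All-drop⁺)
open import Data.List.Relation.Unary.Any using (here; there)
open import Data.List.Membership.Propositional using (_∈_; _∉_)
open import Data.List.Relation.Unary.Unique.Propositional using (Unique)
open import Data.List.Relation.Unary.Unique.Propositional.Properties using () renaming (drop⁺ to Unique-drop⁺)
open import Data.List.Relation.Unary.AllPairs using ([]; _∷_)
open import Data.Sum using (inj₁; inj₂)
open import Data.Unit using (tt)
open import Data.Empty using (⊥-elim)
open import Relation.Nullary using (¬_; yes; no)
open import Relation.Nullary.Decidable.Core using (decidable-stable; ¬¬-excluded-middle)
open import Relation.Binary.PropositionalEquality using (_≡_; _≢_; refl; sym; trans; cong; subst; module ≡-Reasoning)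

module _ {V : Set} where

  private variable
    R : V → V → Set

  _++ʷ_ : ∀ {x y z} → Walk R x y → Walk R y z → Walk R x z
  []      ++ʷ w′ = w′
  (e ∷ w) ++ʷ w′ = e ∷ (w ++ʷ w′)

  len-++ʷ : ∀ {x y z} (w : Walk R x y) (w′ : Walk R y z) → len (w ++ʷ w′) ≡ len w + len w′
  len-++ʷ []      w′ = refl
  len-++ʷ (e ∷ w) w′ = cong suc (len-++ʷ w w′)

  All-++ʷ : ∀ {P : V → Set} {x y z} (w : Walk R x y) (w′ : Walk R y z) →
    All P (verts w) → All P (verts w′) → All P (verts (w ++ʷ w′))
  All-++ʷ []      w′ _          pw′ = pw′
  All-++ʷ (e ∷ w) w′ (px ∷ pw) pw′ = px ∷ All-++ʷ w w′ pw pw′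

  reverseʷ : ∀ {x y} → Walk R x y → Walk (flip R) y x
  reverseʷ []      = []
  reverseʷ (e ∷ w) = reverseʷ w ++ʷ (e ∷ [])

  len-reverseʷ : ∀ {x y} (w : Walk R x y) → len (reverseʷ w) ≡ len w
  len-reverseʷ []      = refl
  len-reverseʷ (e ∷ w) = begin
    len (reverseʷ w ++ʷ (e ∷ [])) ≡⟨ len-++ʷ (reverseʷ w) (e ∷ []) ⟩
    len (reverseʷ w) + 1          ≡⟨ cong (_+ 1) (len-reverseʷ w) ⟩
    len w + 1                     ≡⟨ +-comm (len w) 1 ⟩
    suc (len w)                   ∎
    where open ≡-Reasoning

  All-reverseʷ : ∀ {P : V → Set} {x y} (w : Walk R x y) → All P (verts w) → All P (verts (reverseʷ w))
  All-reverseʷ []      pw        = pw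
  All-reverseʷ (e ∷ w) (px ∷ pw) = All-++ʷ (reverseʷ w) (e ∷ []) (All-reverseʷ w pw) (All-start w pw ∷ px ∷ [])
    where
    All-start : ∀ {P : V → Set} {x y} (w : Walk R x y) → All P (verts w) → P x
    All-start []      (px ∷ _) = px
    All-start (_ ∷ _) (px ∷ _) = px

  suffixʷ : ∀ {x y z} (w : Walk R y z) → x ∈ verts w →
    Σ (Walk R x z) λ w′ → Σ ℕ λ n → verts w′ ≡ drop n (verts w)
  suffixʷ []      (here refl) = [] , 0 , refl
  suffixʷ (e ∷ w) (here refl) = e ∷ w , 0 , refl
  suffixʷ (e ∷ w) (there x∈w) with suffixʷ w x∈w
  ... | w′ , n , eq = w′ , suc n , eq

  suffix-path : ∀ {x y z} (p : Path R y z) → x ∈ verts (proj₁ p) →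
    Σ (Path R x z) λ p′ → ∀ {P : V → Set} → All P (verts (proj₁ p)) → All P (verts (proj₁ p′))
  suffix-path (w , u) x∈w with suffixʷ w x∈w
  ... | w′ , n , eq = (w′ , subst Unique (sym eq) (Unique-drop⁺ n u)) , subst (All _) (sym eq) ∘ All-drop⁺ n

  -- Shortcutting at a repeated vertex needs to decide membership in a list of
  -- vertices of an arbitrary type, so it is only available under ¬¬.
  walk⇒¬¬path : ∀ {P : V → Set} {x y} (w : Walk R x y) → All P (verts w) →
    ¬ ¬ (Σ (Path R x y) λ p → All P (verts (proj₁ p)))
  walk⇒¬¬path []      (px ∷ []) k = k (([] , [] ∷ []) , px ∷ [])
  walk⇒¬¬path {x = x} (e ∷ w) (px ∷ pw) k = walk⇒¬¬path w pw λ where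
    (p@(w′ , u) , pw′) → ¬¬-excluded-middle {A = x ∈ verts w′} λ where
      (yes x∈w′) → let (q , restrict) = suffix-path p x∈w′ in k (q , restrict pw′)
      (no x∉w′)  → k ((e ∷ w′ , ¬Any⇒All¬ _ x∉w′ ∷ u) , px ∷ pw′)

  mapʷ : ∀ {S : V → V → Set} {x y} → R ⇒ S → Walk R x y → Walk S x y
  mapʷ f []      = []
  mapʷ f (e ∷ w) = f e ∷ mapʷ f w

  verts-mapʷ : ∀ {S : V → V → Set} {x y} (f : R ⇒ S) (w : Walk R x y) → verts (mapʷ f w) ≡ verts w
  verts-mapʷ f []      = refl
  verts-mapʷ f (e ∷ w) = cong (_ ∷_) (verts-mapʷ f w)

  All-mapʷ : ∀ {P : V → Set} {S : V → V → Set} {x y} (f : R ⇒ S) (w : Walk R x y) →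
    All P (verts w) → All P (verts (mapʷ f w))
  All-mapʷ f w = subst (All _) (sym (verts-mapʷ f w))

  map-path : ∀ {S : V → V → Set} {x y} → R ⇒ S → Path R x y → Path S x y
  map-path f (w , u) = mapʷ f w , subst Unique (sym (verts-mapʷ f w)) u

  Acyclic-antimono : ∀ {S : V → V → Set} → R ⇒ S → Acyclic S → Acyclic R
  Acyclic-antimono f acyclic (x , y , p , e) = acyclic (x , y , map-path f p , f e)

  Acyclic⇒∉path : Acyclic R → ∀ {x y z} (p : Path R x y) → R y z → z ∉ verts (proj₁ p)
  Acyclic⇒∉path acyclic {y = y} {z} p e z∈p = acyclic (z , y , proj₁ (suffix-path p z∈p) , e)

module ArborescenceProperties {D : Digraph} (T : Arborescence D) where
  open Digraph D
  open Arborescence T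

  Tₑ-acyclic : Acyclic Tₑ
  Tₑ-acyclic (_ , _ , ([] , _) , e)          = loopless (Tₑ⊆E e)
  Tₑ-acyclic (_ , _ , (e′ ∷ [] , _) , e)     = oriented (e′ , e)
  Tₑ-acyclic (x , y , p@(_ ∷ _ ∷ _ , _) , e) = noCycle (x , y , map-path inj₁ p , s≤s (s≤s z≤n) , inj₁ e)

  root-has-no-parent : ∀ {u} → ¬ Tₑ u root
  root-has-no-parent {u} e = Tₑ-acyclic (root , u , reach u (proj₁ (Tₑ-ends e)) , e)

  -- Distinct parents a, b of w would give the cycle w a … root … b w in the
  -- underlying tree; the walk a … root … b avoids w as Tₑ is acyclic.
  parents-¬¬-equal : ∀ {a b w} → Tₑ a w → Tₑ b w → ¬ ¬ a ≡ b
  parents-¬¬-equal {a} {b} {w} ea eb a≢b =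
    walk⇒¬¬path (a⇝root ++ʷ root⇝b) (All-++ʷ a⇝root root⇝b w∉a⇝root w∉root⇝b) λ where
      (([] , _) , _)          → a≢b refl
      ((p@(_ ∷ _) , u) , w∉p) → noCycle (w , b , (inj₂ ea ∷ p , w∉p ∷ u) , s≤s (s≤s z≤n) , inj₁ eb)
    where
    root⇝a : Path Tₑ root a
    root⇝a = reach a (proj₁ (Tₑ-ends ea))
    root⇝b′ : Path Tₑ root b
    root⇝b′ = reach b (proj₁ (Tₑ-ends eb))
    a⇝root : Walk (UAdj Tₑ) a root
    a⇝root = mapʷ inj₂ (reverseʷ (proj₁ root⇝a))
    root⇝b : Walk (UAdj Tₑ) root b
    root⇝b = mapʷ inj₁ (proj₁ root⇝b′)
    w∉a⇝root : All (w ≢_) (verts a⇝root)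
    w∉a⇝root = All-mapʷ inj₂ (reverseʷ (proj₁ root⇝a))
      (All-reverseʷ (proj₁ root⇝a) (¬Any⇒All¬ _ (Acyclic⇒∉path Tₑ-acyclic root⇝a ea)))
    w∉root⇝b : All (w ≢_) (verts root⇝b)
    w∉root⇝b = All-mapʷ inj₁ (proj₁ root⇝b′) (¬Any⇒All¬ _ (Acyclic⇒∉path Tₑ-acyclic root⇝b′ eb))

  walks-to-root-same-length : ∀ {w} (p q : Walk (flip Tₑ) w root) → len p ≡ len q
  walks-to-root-same-length []      []       = refl
  walks-to-root-same-length []      (e ∷ _)  = ⊥-elim (root-has-no-parent e)
  walks-to-root-same-length (e ∷ _) []       = ⊥-elim (root-has-no-parent e)
  walks-to-root-same-length (e ∷ p) (e′ ∷ q) = decidable-stable (suc (len p) ≟ suc (len q)) λ ≢ →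
    parents-¬¬-equal e e′ λ { refl → ≢ (cong suc (walks-to-root-same-length p q)) }

  walks-from-root-same-length : ∀ {v} (p q : Walk Tₑ root v) → len p ≡ len q
  walks-from-root-same-length p q = begin
    len p              ≡⟨ sym (len-reverseʷ p) ⟩
    len (reverseʷ p)   ≡⟨ walks-to-root-same-length (reverseʷ p) (reverseʷ q) ⟩
    len (reverseʷ q)   ≡⟨ len-reverseʷ q ⟩
    len q              ∎
    where open ≡-Reasoning

module Depth {D : Digraph} (T : Arborescence D) (spanning : IsSpanning T) where
  open Digraph D
  open Arborescence T
  open ArborescenceProperties T

  depth : V → ℕ
  depth v = len (proj₁ (reach v (spanning v)))

  depth-++ : ∀ {u v} (p : Walk Tₑ u v) → depth v ≡ depth u + len p
  depth-++ {u} p = trans (walks-from-root-same-length _ (root⇝u ++ʷ p)) (len-++ʷ root⇝u p)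
    where
    root⇝u : Walk Tₑ root u
    root⇝u = proj₁ (reach u (spanning u))

  same-depth⇒¬walk : ∀ {u v} → depth u ≡ depth v → u ≢ v → ¬ Walk Tₑ u v
  same-depth⇒¬walk eq u≢v []        = u≢v refl
  same-depth⇒¬walk eq u≢v p@(_ ∷ _) = m+1+n≢m _ (sym (trans eq (depth-++ p)))

  same-depth-edge⇒assistant-edge : ∀ {u v} → E u v → depth u ≡ depth v → NormalAssistant T u v
  same-depth-edge⇒assistant-edge {u} {v} e eq = inj₂
    ( (spanning u , spanning v , same-depth⇒¬walk eq u≢v ∘ proj₁ , same-depth⇒¬walk (sym eq) (u≢v ∘ sym) ∘ proj₁)
    , u , v , ([] , [] ∷ []) , ([] , [] ∷ [])
    , (spanning u , spanning v , (e ∷ [] , (u≢v ∷ []) ∷ [] ∷ []) , s≤s z≤n , tt) )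
    where
    u≢v : u ≢ v
    u≢v refl = loopless e

proposition3p5 : (D : Digraph) → (T : Arborescence D) → IsSpanning T → IsNormal T → CountableDichromatic D
proposition3p5 D T spanning normal = depth , λ _ → Acyclic-antimono level-edge normal
  where
  open Depth T spanning
  level-edge : ∀ {k} → Induced D (λ v → depth v ≡ k) ⇒ NormalAssistant T
  level-edge (du , dv , e) = same-depth-edge⇒assistant-edge e (trans du (sym dv))
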